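{- Let $\pi\in\mathfrak{S}_n$ with $I(\pi)=(c_1,\dots,c_n)$. For any $1\le i\le n-1$, if $c_i\ge c_{i+1}$, then in the permutation $\Psi(\pi)$ the letter $i+1$ is not immediately followed by the letter $i$.
   Context: For $\pi\in\mathfrak{S}_n$, $I(\pi)=(c_1,\dots,c_n)$ where $c_i$ is the number of letters $j<i$ that lie to the right of the letter $i$ in $\pi$. A descent of a permutation $\sigma$ is an index $j$ with $\sigma_j>\sigma_{j+1}$. The bijection $\Psi:\mathfrak{S}_n\to\mathfrak{S}_n$ is defined recursively: $\Psi(1)=1$; for $\pi\in\mathfrak{S}_n$ ($n\ge2$) with $I(\pi)=(c_1,\dots,c_n)$, let $\pi'$ be $\pi$ with the letter $n$ deleted; label the $n$ positions (gaps) of $\Psi(\pi')$: (a) the position after the last letter gets label $0$; (b) the positions immediately following the descents of $\Psi(\pi')$ get labels $1,\dots,\mathrm{des}(\Psi(\pi'))$ from right to left; (c) the remaining positions get labels $\mathrm{des}(\Psi(\pi'))+1,\dots,n-1$ from left to right. Then $\Psi(\pi)$ is obtained by inserting $n$ into the position labeled $c_n$. -}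

module Defs where

open import Data.Nat using (ℕ; zero; suc; _+_; _∸_; _<ᵇ_; _≡ᵇ_; _≤_; _<_)
open import Data.Bool using (Bool; true; false; if_then_else_)
open import Data.List using (List; []; _∷_; _++_; length; reverse; map; upTo)
open import Data.Product using (Σ; ∃; _,_)
open import Relation.Binary.PropositionalEquality using (_≡_)

-- Permutations of [n] are lists in one-line notation, containing 1..n.
-- The list [1, 2, ..., n]:
oneToN : ℕ → List ℕ
oneToN n = map suc (upTo n)

after : ℕ → List ℕ → List ℕ
after x []       = []
after x (y ∷ ys) = if x ≡ᵇ y then ys else after x ys

countLess : ℕ → List ℕ → ℕ
countLess i []       = 0
countLess i (y ∷ ys) = (if y <ᵇ i then 1 else 0) + countLess i ys

-- inversion code: c_i(π) = #{ j < i : j lies to the right of i in π }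
code : List ℕ → ℕ → ℕ
code π i = countLess i (after i π)

delete : ℕ → List ℕ → List ℕ
delete x []       = []
delete x (y ∷ ys) = if x ≡ᵇ y then delete x ys else y ∷ delete x ys

insertAt : ℕ → ℕ → List ℕ → List ℕ
insertAt zero    x ys       = x ∷ ys
insertAt (suc p) x []       = x ∷ []
insertAt (suc p) x (y ∷ ys) = y ∷ insertAt p x ys

nth : ℕ → List ℕ → ℕ
nth _       []       = 0
nth zero    (y ∷ ys) = y
nth (suc k) (y ∷ ys) = nth k ys

-- Gaps of σ (length m) are the positions 0..m (position p = after the first p letters).
-- Gap p (1 ≤ p < m) immediately follows a descent iff σ_p > σ_{p+1}.
-- descGaps: ascending list of gaps immediately following a descent,
-- otherGaps: ascending list of the remaining gaps among 0..m-1.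
-- (helpers work on the list with the current position counter k)
descGapsFrom : ℕ → List ℕ → List ℕ
descGapsFrom k []           = []
descGapsFrom k (a ∷ [])     = []
descGapsFrom k (a ∷ b ∷ xs) =
  if b <ᵇ a then suc k ∷ descGapsFrom (suc k) (b ∷ xs) else descGapsFrom (suc k) (b ∷ xs)

otherGapsFrom : ℕ → List ℕ → List ℕ
otherGapsFrom k []           = []
otherGapsFrom k (a ∷ [])     = []
otherGapsFrom k (a ∷ b ∷ xs) =
  if b <ᵇ a then otherGapsFrom (suc k) (b ∷ xs) else suc k ∷ otherGapsFrom (suc k) (b ∷ xs)

descGaps : List ℕ → List ℕ
descGaps σ = descGapsFrom 0 σ

-- gap 0 (before the first letter) is never after a descent; gap m is labelled 0
otherGaps : List ℕ → List ℕ
otherGaps []      = []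
otherGaps (a ∷ σ) = 0 ∷ otherGapsFrom 0 (a ∷ σ)

-- the gap of σ carrying label c:
-- label 0 = gap after last letter; labels 1..d = descent gaps from right to left;
-- labels d+1.. = remaining gaps from left to right.
gapWithLabel : List ℕ → ℕ → ℕ
gapWithLabel σ zero    = length σ
gapWithLabel σ (suc c) =
  if c <ᵇ length (descGaps σ)
  then nth c (reverse (descGaps σ))
  else nth (c ∸ length (descGaps σ)) (otherGaps σ)

-- ΨAux k π: Ψ applied to the restriction of π to letters 1..k
ΨAux : ℕ → List ℕ → List ℕ
ΨAux zero    π = []
ΨAux (suc k) π = insertAt (gapWithLabel (ΨAux k (delete (suc k) π)) (code π (suc k)))
                          (suc k) (ΨAux k (delete (suc k) π))

Ψ : List ℕ → List ℕ
Ψ π = ΨAux (length π) π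

ImmFollowedBy : ℕ → ℕ → List ℕ → Set
ImmFollowedBy a b l = Σ (List ℕ) λ xs → Σ (List ℕ) λ ys → l ≡ xs ++ a ∷ b ∷ ys

{-# OPTIONS --safe #-}
-- Ψ inserts the letters 1, 2, … in increasing order, and inserting a letter other than a and b
-- never makes a immediately followed by b, so only the insertion of i + 1 matters.  Just before
-- it, i was inserted as the largest letter into the gap p of label c_i (a valid label, as
-- c_i ≤ i - 1).  This replaces gap p by an ascent into i followed by a descent out of it: the
-- descents keep their right-to-left order and do not become fewer, and the non-descent gaps to
-- the left of p are unchanged, while p itself becomes a non-descent gap.  Hence no label ≤ c_i
-- now points at p, and i + 1, inserted at the gap of label c_{i+1} ≤ c_i, does not land
-- immediately before i.
module Submission where

open import Defs
open import Data.Nat using (ℕ; zero; suc; _+_; _∸_; _<ᵇ_; _≡ᵇ_; _≤_; _<_; z≤n; s≤s; z<s; _⊓_)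
open import Data.Nat.Properties
open import Data.Bool using (Bool; true; false; not; _xor_; if_then_else_; T)
open import Data.Unit using (tt)
open import Data.List using (List; []; _∷_; _++_; length; reverse; map; upTo; _∷ʳ_)
open import Data.List.Properties using (∷-injective; ∷-injectiveˡ; ∷-injectiveʳ; length-++; length-reverse; length-map; length-upTo; upTo-∷ʳ)
open import Data.List.Relation.Unary.All as All using (All; []; _∷_)
open import Data.List.Relation.Unary.All.Properties using (++⁺; ++⁻ʳ)
open import Data.List.Relation.Binary.Permutation.Propositional using (_↭_; ↭-sym)
import Data.List.Relation.Binary.Permutation.Propositional as ↭
open import Data.List.Relation.Binary.Permutation.Propositional.Properties using (All-resp-↭; ↭-reverse; ↭-length)
open import Data.Product using (Σ; _,_; _×_; proj₁; proj₂)
import Data.Product as Product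
open import Data.Sum using (inj₁; inj₂)
open import Data.Empty using (⊥-elim)
open import Function using (_∘_)
open import Relation.Nullary using (¬_; Dec; yes; no)
open import Relation.Binary.PropositionalEquality

<⇒<ᵇ≡true : ∀ {m n} → m < n → (m <ᵇ n) ≡ true
<⇒<ᵇ≡true {zero}  {suc n} _         = refl
<⇒<ᵇ≡true {suc m} {suc n} (s≤s m<n) = <⇒<ᵇ≡true m<n

≥⇒<ᵇ≡false : ∀ {m n} → n ≤ m → (m <ᵇ n) ≡ false
≥⇒<ᵇ≡false {m}     {zero}  _         = refl
≥⇒<ᵇ≡false {suc m} {suc n} (s≤s n≤m) = ≥⇒<ᵇ≡false n≤m

positions : Bool → ℕ → List Bool → List ℕ
positions b k []       = []
positions b k (x ∷ xs) = if x xor b then positions b (suc k) xs else k ∷ positions b (suc k) xs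

positions-++ : ∀ b k A R → positions b k (A ++ R) ≡ positions b k A ++ positions b (k + length A) R
positions-++ b k []      R rewrite +-identityʳ k = refl
positions-++ b k (x ∷ A) R rewrite +-suc k (length A) with x xor b
... | true  = positions-++ b (suc k) A R
... | false = cong (k ∷_) (positions-++ b (suc k) A R)

positions-≥ : ∀ b k A → All (k ≤_) (positions b k A)
positions-≥ b k []      = []
positions-≥ b k (x ∷ A) with x xor b
... | true  = All.map (≤-trans (n≤1+n k)) (positions-≥ b (suc k) A)
... | false = ≤-refl ∷ All.map (≤-trans (n≤1+n k)) (positions-≥ b (suc k) A)

positions-< : ∀ b k A → All (_< k + length A) (positions b k A)
positions-< b k []      = []
positions-< b k (x ∷ A) rewrite +-suc k (length A) with x xor b
... | true  = positions-< b (suc k) A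
... | false = s≤s (m≤m+n k (length A)) ∷ positions-< b (suc k) A

length-positions-offset : ∀ b k k′ A → length (positions b k A) ≡ length (positions b k′ A)
length-positions-offset b k k′ []      = refl
length-positions-offset b k k′ (x ∷ A) with x xor b
... | true  = length-positions-offset b (suc k) (suc k′) A
... | false = cong suc (length-positions-offset b (suc k) (suc k′) A)

length-positions-++ : ∀ b A R → length (positions b 0 (A ++ R)) ≡ length (positions b 0 A) + length (positions b 0 R)
length-positions-++ b A R = begin
  length (positions b 0 (A ++ R))                          ≡⟨ cong length (positions-++ b 0 A R) ⟩
  length (positions b 0 A ++ positions b (length A) R)     ≡⟨ length-++ (positions b 0 A) ⟩
  length (positions b 0 A) + length (positions b (length A) R)
    ≡⟨ cong (length (positions b 0 A) +_) (length-positions-offset b (length A) 0 R) ⟩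
  length (positions b 0 A) + length (positions b 0 R)      ∎
  where open ≡-Reasoning

length-positions-true+false : ∀ k A → length (positions true k A) + length (positions false k A) ≡ length A
length-positions-true+false k []          = refl
length-positions-true+false k (true ∷ A)  = cong suc (length-positions-true+false (suc k) A)
length-positions-true+false k (false ∷ A) =
  trans (+-suc _ _) (cong suc (length-positions-true+false (suc k) A))

positions-avoid : ∀ x k A C → All (_≢ k + length A) (positions (not x) k (A ++ x ∷ C))
positions-avoid x k A C rewrite positions-++ (not x) k A (x ∷ C) =
  ++⁺ (All.map <⇒≢ (positions-< (not x) k A)) (beyond x)
  where
    beyond : ∀ y → All (_≢ k + length A) (positions (not y) (k + length A) (y ∷ C))
    beyond true  = All.map >⇒≢ (positions-≥ false (suc (k + length A)) C)
    beyond false = All.map >⇒≢ (positions-≥ true  (suc (k + length A)) C)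

nth-All : ∀ {P : ℕ → Set} {xs} e → All P xs → e < length xs → P (nth e xs)
nth-All zero    (p ∷ _)  _         = p
nth-All (suc e) (_ ∷ ps) (s≤s e<n) = nth-All e ps e<n

nth-++ˡ : ∀ e xs ys → e < length xs → nth e (xs ++ ys) ≡ nth e xs
nth-++ˡ zero    (x ∷ xs) ys _         = refl
nth-++ˡ (suc e) (x ∷ xs) ys (s≤s e<n) = nth-++ˡ e xs ys e<n

nth-≡⇒index-≤ : ∀ {a} xs ys e → All (_≢ a) ys → e < length (xs ++ a ∷ ys) →
                nth e (xs ++ a ∷ ys) ≡ a → e ≤ length xs
nth-≡⇒index-≤ []       ys zero    _   _         _  = z≤n
nth-≡⇒index-≤ []       ys (suc e) ys≢ (s≤s e<n) eq = ⊥-elim (nth-All e ys≢ e<n eq)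
nth-≡⇒index-≤ (x ∷ xs) ys zero    _   _         _  = z≤n
nth-≡⇒index-≤ (x ∷ xs) ys (suc e) ys≢ (s≤s e<n) eq = s≤s (nth-≡⇒index-≤ xs ys e ys≢ e<n eq)

labelledGap : List Bool → ℕ → ℕ
labelledGap B zero    = length B
labelledGap B (suc c) =
  if c <ᵇ length (positions true 0 B)
  then nth c (reverse (positions true 0 B))
  else nth (c ∸ length (positions true 0 B)) (positions false 0 B)

module _ (B : List Bool) where
  private
    d = length (positions true 0 B)

  labelledGap-descent : ∀ {P : ℕ → Set} {f} → All P (positions true 0 B) → f < d →
                        P (labelledGap B (suc f))
  labelledGap-descent {f = f} all f<d rewrite <⇒<ᵇ≡true f<d =
    nth-All f (All-resp-↭ (↭-sym (↭-reverse _)) all)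
              (subst (f <_) (sym (length-reverse (positions true 0 B))) f<d)

  labelledGap-other-≡ : ∀ {f} → d ≤ f → labelledGap B (suc f) ≡ nth (f ∸ d) (positions false 0 B)
  labelledGap-other-≡ d≤f rewrite ≥⇒<ᵇ≡false d≤f = refl

  other-index< : ∀ {f} → d ≤ f → f < length B → f ∸ d < length (positions false 0 B)
  other-index< {f} d≤f f<n = begin-strict
    f ∸ d                                      <⟨ ∸-monoˡ-< f<n d≤f ⟩
    length B ∸ d                               ≡⟨ cong (_∸ d) (sym (length-positions-true+false 0 B)) ⟩
    d + length (positions false 0 B) ∸ d       ≡⟨ m+n∸m≡n d _ ⟩
    length (positions false 0 B)               ∎
    where open ≤-Reasoning

  labelledGap-other : ∀ {P : ℕ → Set} {f} → All P (positions false 0 B) → d ≤ f → f < length B →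
                      P (labelledGap B (suc f))
  labelledGap-other {P} {f} all d≤f f<n =
    subst P (sym (labelledGap-other-≡ d≤f)) (nth-All (f ∸ d) all (other-index< d≤f f<n))

  labelledGap-< : ∀ {f} → f < length B → labelledGap B (suc f) < length B
  labelledGap-< {f} f<n with f <? d
  ... | yes f<d = labelledGap-descent (positions-< true 0 B) f<d
  ... | no  f≮d = labelledGap-other (positions-< false 0 B) (≮⇒≥ f≮d) f<n

module _ (A C : List Bool) where
  private
    p  = length A
    B′ = A ++ false ∷ true ∷ C
    dA = length (positions true 0 A)
    d′ = length (positions true 0 B′)

    d : Bool → ℕ
    d β = length (positions true 0 (A ++ β ∷ C))

    F : List Bool → List ℕ
    F = positions false 0

    B = A ++ false ∷ C

    descents-peak-true : d′ ≡ d true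
    descents-peak-true = begin
      d′                                      ≡⟨ length-positions-++ true A (false ∷ true ∷ C) ⟩
      dA + suc (length (positions true 2 C))  ≡⟨ cong (λ n → dA + suc n) (length-positions-offset true 2 1 C) ⟩
      dA + suc (length (positions true 1 C))  ≡⟨ sym (length-positions-++ true A (true ∷ C)) ⟩
      d true                                  ∎
      where open ≡-Reasoning

    descents-peak-false : d′ ≡ suc (d false)
    descents-peak-false = begin
      d′                                      ≡⟨ length-positions-++ true A (false ∷ true ∷ C) ⟩
      dA + suc (length (positions true 2 C))  ≡⟨ +-suc dA _ ⟩
      suc (dA + length (positions true 2 C))  ≡⟨ cong (λ n → suc (dA + n)) (length-positions-offset true 2 1 C) ⟩
      suc (dA + length (positions true 1 C))  ≡⟨ cong suc (sym (length-positions-++ true A (false ∷ C))) ⟩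
      suc (d false)                           ∎
      where open ≡-Reasoning

    peak-other-false : ∀ {f e} → f < length B → labelledGap B (suc f) ≡ p → d false ≤ f →
                       e ≤ f → d′ ≤ e → labelledGap B′ (suc e) ≢ p
    -- Gap p is the k-th non-descent gap of B and B′ has one descent more, so label suc e (e ≤ f)
    -- of B′ names a non-descent gap to the left of p.
    peak-other-false {f} {e} f<n hp d≤f e≤f d′≤e eq =
      nth-All j (All.map <⇒≢ (positions-< false 0 A)) j<|FA| (begin
        nth j (F A)                   ≡⟨ sym (nth-++ˡ j (F A) _ j<|FA|) ⟩
        nth j (F A ++ F′)             ≡⟨ cong (nth j) (sym (positions-++ false 0 A (false ∷ true ∷ C))) ⟩
        nth j (F B′)                  ≡⟨ sym (labelledGap-other-≡ B′ d′≤e) ⟩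
        labelledGap B′ (suc e)        ≡⟨ eq ⟩
        p                             ∎)
      where
        open ≡-Reasoning
        F′ = positions false p (false ∷ true ∷ C)
        k = f ∸ d false
        j = e ∸ d′
        F-split : F B ≡ F A ++ p ∷ positions false (suc p) C
        F-split = positions-++ false 0 A (false ∷ C)
        k≤|FA| : k ≤ length (F A)
        k≤|FA| = nth-≡⇒index-≤ (F A) _ k (All.map >⇒≢ (positions-≥ false (suc p) C))
                   (subst (λ X → k < length X) F-split (other-index< B d≤f f<n))
                   (subst (λ X → nth k X ≡ p) F-split (trans (sym (labelledGap-other-≡ B d≤f)) hp))
        j<k : j < k
        j<k = subst (λ n → e ∸ n < k) (sym descents-peak-false)
          (<-≤-trans (∸-monoʳ-< (n<1+n (d false)) (subst (_≤ e) descents-peak-false d′≤e))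
                     (∸-monoˡ-≤ (d false) e≤f))
        j<|FA| : j < length (F A)
        j<|FA| = <-≤-trans j<k k≤|FA|

    peak-other : ∀ β {f e} → f < length (A ++ β ∷ C) → labelledGap (A ++ β ∷ C) (suc f) ≡ p →
                 e ≤ f → d′ ≤ e → labelledGap B′ (suc e) ≢ p
    peak-other true  {f} f<n hp e≤f d′≤e with f <? d true
    ... | yes f<d = ⊥-elim (<⇒≱ f<d (≤-trans (subst (_≤ _) descents-peak-true d′≤e) e≤f))
    ... | no  f≮d = ⊥-elim (labelledGap-other (A ++ true ∷ C) (positions-avoid true 0 A C) (≮⇒≥ f≮d) f<n hp)
    peak-other false {f} f<n hp e≤f d′≤e with f <? d false
    ... | yes f<d = ⊥-elim (labelledGap-descent B (positions-avoid false 0 A C) f<d hp)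
    ... | no  f≮d = peak-other-false f<n hp (≮⇒≥ f≮d) e≤f d′≤e

  labelledGap-peak : ∀ β {f c′} → f < length (A ++ β ∷ C) → labelledGap (A ++ β ∷ C) (suc f) ≡ p →
                     c′ ≤ suc f → labelledGap B′ c′ ≢ p
  labelledGap-peak β f<n hp z≤n = >⇒≢ (subst (p <_) (sym (length-++ A)) (m<m+n p z<s))
  labelledGap-peak β f<n hp (s≤s {e} e≤f) with e <? d′
  ... | yes e<d′ = labelledGap-descent B′ (positions-avoid false 0 A (true ∷ C)) e<d′
  ... | no  e≮d′ = peak-other β f<n hp e≤f (≮⇒≥ e≮d′)

record PeakInsertion (p : ℕ) (B B′ : List Bool) : Set where
  constructor peakInsertion
  field
    prefix         : List Bool
    bit            : Bool
    suffix         : List Bool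
    length-prefix  : length prefix ≡ p
    profile-before : B  ≡ prefix ++ bit ∷ suffix
    profile-after  : B′ ≡ prefix ++ false ∷ true ∷ suffix

peakInsertion-∷ : ∀ {p B B′} x → PeakInsertion p B B′ → PeakInsertion (suc p) (x ∷ B) (x ∷ B′)
peakInsertion-∷ x (peakInsertion A β C refl refl refl) = peakInsertion (x ∷ A) β C refl refl refl

-- Bit g is true iff gap g of the word immediately follows a descent.
descentsAfter : ℕ → List ℕ → List Bool
descentsAfter a []      = []
descentsAfter a (b ∷ l) = (b <ᵇ a) ∷ descentsAfter b l

descentProfile : List ℕ → List Bool
descentProfile []      = []
descentProfile (a ∷ l) = false ∷ descentsAfter a l

length-descentsAfter : ∀ a l → length (descentsAfter a l) ≡ length l
length-descentsAfter a []      = refl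
length-descentsAfter a (b ∷ l) = cong suc (length-descentsAfter b l)

length-descentProfile : ∀ σ → length (descentProfile σ) ≡ length σ
length-descentProfile []      = refl
length-descentProfile (a ∷ l) = cong suc (length-descentsAfter a l)

descGapsFrom≡positions : ∀ k a l → descGapsFrom k (a ∷ l) ≡ positions true (suc k) (descentsAfter a l)
descGapsFrom≡positions k a []      = refl
descGapsFrom≡positions k a (b ∷ l) with b <ᵇ a
... | true  = cong (suc k ∷_) (descGapsFrom≡positions (suc k) b l)
... | false = descGapsFrom≡positions (suc k) b l

otherGapsFrom≡positions : ∀ k a l → otherGapsFrom k (a ∷ l) ≡ positions false (suc k) (descentsAfter a l)
otherGapsFrom≡positions k a []      = refl
otherGapsFrom≡positions k a (b ∷ l) with b <ᵇ a
... | true  = otherGapsFrom≡positions (suc k) b l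
... | false = cong (suc k ∷_) (otherGapsFrom≡positions (suc k) b l)

descGaps≡positions : ∀ σ → descGaps σ ≡ positions true 0 (descentProfile σ)
descGaps≡positions []      = refl
descGaps≡positions (a ∷ l) = descGapsFrom≡positions 0 a l

otherGaps≡positions : ∀ σ → otherGaps σ ≡ positions false 0 (descentProfile σ)
otherGaps≡positions []      = refl
otherGaps≡positions (a ∷ l) = cong (0 ∷_) (otherGapsFrom≡positions 0 a l)

gapWithLabel≡labelledGap : ∀ σ c → gapWithLabel σ c ≡ labelledGap (descentProfile σ) c
gapWithLabel≡labelledGap σ zero    = sym (length-descentProfile σ)
gapWithLabel≡labelledGap σ (suc c) rewrite descGaps≡positions σ | otherGaps≡positions σ = refl

gapWithLabel-< : ∀ σ {c} → c < length σ → gapWithLabel σ (suc c) < length σ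
gapWithLabel-< σ {c} c<n =
  subst₂ _<_ (sym (gapWithLabel≡labelledGap σ (suc c))) (length-descentProfile σ)
    (labelledGap-< (descentProfile σ) (subst (c <_) (sym (length-descentProfile σ)) c<n))

gapWithLabel-≤ : ∀ σ {c} → c ≤ length σ → gapWithLabel σ c ≤ length σ
gapWithLabel-≤ σ {zero}  _   = ≤-refl
gapWithLabel-≤ σ {suc c} c<n = <⇒≤ (gapWithLabel-< σ c<n)

descentsAfter-insertAt-max : ∀ {a x l p} → a < x → All (_< x) l → p < length l →
  PeakInsertion p (descentsAfter a l) (descentsAfter a (insertAt p x l))
descentsAfter-insertAt-max {a} {x} {b ∷ l} {zero} a<x (b<x ∷ _) _
  rewrite ≥⇒<ᵇ≡false (<⇒≤ a<x) | <⇒<ᵇ≡true b<x =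
  peakInsertion [] (b <ᵇ a) (descentsAfter b l) refl refl refl
descentsAfter-insertAt-max {a} {x} {b ∷ l} {suc p} a<x (b<x ∷ l<x) (s≤s p<n) =
  peakInsertion-∷ (b <ᵇ a) (descentsAfter-insertAt-max b<x l<x p<n)

descentProfile-insertAt-max : ∀ {x τ p} → All (_< x) τ → p < length τ →
  PeakInsertion p (descentProfile τ) (descentProfile (insertAt p x τ))
descentProfile-insertAt-max {x} {a ∷ l} {zero} (a<x ∷ _) _ rewrite <⇒<ᵇ≡true a<x =
  peakInsertion [] false (descentsAfter a l) refl refl refl
descentProfile-insertAt-max {x} {a ∷ l} {suc p} (a<x ∷ l<x) (s≤s p<n) =
  peakInsertion-∷ false (descentsAfter-insertAt-max a<x l<x p<n)

length-insertAt : ∀ p (x : ℕ) l → length (insertAt p x l) ≡ suc (length l)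
length-insertAt zero    x l       = refl
length-insertAt (suc p) x []      = refl
length-insertAt (suc p) x (y ∷ l) = cong suc (length-insertAt p x l)

All-insertAt : ∀ {P : ℕ → Set} p {x l} → All P l → P x → All P (insertAt p x l)
All-insertAt zero    ps       px = px ∷ ps
All-insertAt (suc p) []       px = px ∷ []
All-insertAt (suc p) (q ∷ ps) px = q ∷ All-insertAt p ps px

gapWithLabel-insertAt-max : ∀ {x τ c c′} → All (_< x) τ → c ≤ length τ → c′ ≤ c →
  gapWithLabel (insertAt (gapWithLabel τ c) x τ) c′ ≢ gapWithLabel τ c
gapWithLabel-insertAt-max {x} {τ} {zero} _ _ z≤n eq =
  1+n≢n (trans (sym (length-insertAt (length τ) x τ)) eq)
gapWithLabel-insertAt-max {x} {τ} {suc f} {c′} τ<x f<n c′≤c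
  with descentProfile-insertAt-max {x} τ<x (gapWithLabel-< τ f<n)
... | peakInsertion A β C |A|≡p before after =
  subst₂ _≢_ (sym inserted) |A|≡p (labelledGap-peak A C β f<|B| chosen c′≤c)
  where
    inserted : gapWithLabel (insertAt (gapWithLabel τ (suc f)) x τ) c′ ≡ labelledGap (A ++ false ∷ true ∷ C) c′
    inserted = trans (gapWithLabel≡labelledGap _ c′) (cong (λ B → labelledGap B c′) after)
    chosen : labelledGap (A ++ β ∷ C) (suc f) ≡ length A
    chosen = trans (cong (λ B → labelledGap B (suc f)) (sym before))
                   (trans (sym (gapWithLabel≡labelledGap τ (suc f))) (sym |A|≡p))
    f<|B| : f < length (A ++ β ∷ C)
    f<|B| = subst (λ B → f < length B) before (subst (f <_) (sym (length-descentProfile τ)) f<n)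

no-maximum-inside : ∀ {y} xs {r} → ¬ All (_< y) (xs ++ y ∷ r)
no-maximum-inside xs all with ++⁻ʳ xs all
... | y<y ∷ _ = <-irrefl refl y<y

insertAt-max-split : ∀ {y q l} xs {r} → All (_< y) l → q ≤ length l → insertAt q y l ≡ xs ++ y ∷ r →
                     length xs ≡ q × l ≡ xs ++ r
insertAt-max-split {q = zero} []       _ _ eq = refl , ∷-injectiveʳ eq
insertAt-max-split {q = zero} (x ∷ xs) l<y _ eq with ∷-injective eq
... | refl , eq′ = ⊥-elim (no-maximum-inside xs (subst (All _) eq′ l<y))
insertAt-max-split {q = suc q} {w ∷ l} []       (w<y ∷ _) _ eq = ⊥-elim (<-irrefl (∷-injectiveˡ eq) w<y)
insertAt-max-split {q = suc q} {w ∷ l} (x ∷ xs) (_ ∷ l<y) (s≤s q≤n) eq with ∷-injective eq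
... | refl , eq′ = Product.map (cong suc) (cong (w ∷_)) (insertAt-max-split xs l<y q≤n eq′)

insertAt-two-maxima : ∀ {y c c′} τ → All (_< y) τ → c ≤ length τ → c′ ≤ c →
  let σ = insertAt (gapWithLabel τ c) y τ in
  ¬ ImmFollowedBy (suc y) y (insertAt (gapWithLabel σ c′) (suc y) σ)
insertAt-two-maxima {y} {c} {c′} τ τ<y c≤n c′≤c (xs , ys , eq) =
  gapWithLabel-insertAt-max τ<y c≤n c′≤c (trans (sym (proj₁ larger-placed)) (proj₁ smaller-placed))
  where
    σ = insertAt (gapWithLabel τ c) y τ
    σ<1+y : All (_< suc y) σ
    σ<1+y = All-insertAt (gapWithLabel τ c) (All.map m<n⇒m<1+n τ<y) (n<1+n y)
    c′≤|σ| : c′ ≤ length σ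
    c′≤|σ| = ≤-trans c′≤c (≤-trans c≤n (subst (length τ ≤_) (sym (length-insertAt (gapWithLabel τ c) y τ)) (n≤1+n _)))
    larger-placed = insertAt-max-split xs σ<1+y (gapWithLabel-≤ σ c′≤|σ|) eq
    smaller-placed = insertAt-max-split xs τ<y (gapWithLabel-≤ τ c≤n) (proj₂ larger-placed)

insertAt-head : ∀ {y b ys} p l → y ≢ b → insertAt p y l ≡ b ∷ ys → Σ (List ℕ) λ l′ → l ≡ b ∷ l′
insertAt-head zero    l       y≢b eq = ⊥-elim (y≢b (∷-injectiveˡ eq))
insertAt-head (suc p) []      y≢b eq = ⊥-elim (y≢b (∷-injectiveˡ eq))
insertAt-head (suc p) (v ∷ l) _   eq = l , cong (_∷ l) (∷-injectiveˡ eq)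

ImmFollowedBy-insertAt⁻ : ∀ {a b y} p l → y ≢ a → y ≢ b →
                          ImmFollowedBy a b (insertAt p y l) → ImmFollowedBy a b l
ImmFollowedBy-insertAt⁻ zero    l       y≢a _ ([] , ys , eq)     = ⊥-elim (y≢a (∷-injectiveˡ eq))
ImmFollowedBy-insertAt⁻ zero    l       _   _ (x ∷ xs , ys , eq) = xs , ys , ∷-injectiveʳ eq
ImmFollowedBy-insertAt⁻ (suc p) []      _   _ ([] , ys , ())
ImmFollowedBy-insertAt⁻ (suc p) []      _   _ (x ∷ [] , ys , ())
ImmFollowedBy-insertAt⁻ (suc p) []      _   _ (x ∷ x′ ∷ xs , ys , ())
ImmFollowedBy-insertAt⁻ (suc p) (w ∷ l) _   y≢b ([] , ys , eq) with ∷-injective eq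
... | refl , eq′ with insertAt-head p l y≢b eq′
...   | l′ , refl = [] , l′ , refl
ImmFollowedBy-insertAt⁻ (suc p) (w ∷ l) y≢a y≢b (x ∷ xs , ys , eq) with ∷-injective eq
... | refl , eq′ with ImmFollowedBy-insertAt⁻ p l y≢a y≢b (xs , ys , eq′)
...   | xs′ , ys′ , refl = w ∷ xs′ , ys′ , refl

length-ΨAux : ∀ k π → length (ΨAux k π) ≡ k
length-ΨAux zero    π = refl
length-ΨAux (suc k) π =
  trans (length-insertAt (gapWithLabel τ (code π (suc k))) (suc k) τ) (cong suc (length-ΨAux k (delete (suc k) π)))
  where τ = ΨAux k (delete (suc k) π)

ΨAux-< : ∀ k π → All (_< suc k) (ΨAux k π)
ΨAux-< zero    π = []
ΨAux-< (suc k) π = All-insertAt _ (All.map m<n⇒m<1+n (ΨAux-< k (delete (suc k) π))) (n<1+n (suc k))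

≡ᵇ-true⇒≡ : ∀ {m n} → (m ≡ᵇ n) ≡ true → m ≡ n
≡ᵇ-true⇒≡ {m} {n} eq = ≡ᵇ⇒≡ m n (subst T (sym eq) tt)

after-delete : ∀ j k π → j ≢ k → after j (delete k π) ≡ delete k (after j π)
after-delete j k []       _   = refl
after-delete j k (y ∷ ys) j≢k with k ≡ᵇ y in k≡y
... | false with j ≡ᵇ y
...   | true  = refl
...   | false = after-delete j k ys j≢k
after-delete j k (y ∷ ys) j≢k | true with j ≡ᵇ y in j≡y
...   | true  = ⊥-elim (j≢k (trans (≡ᵇ-true⇒≡ j≡y) (sym (≡ᵇ-true⇒≡ k≡y))))
...   | false = after-delete j k ys j≢k

countLess-delete : ∀ j k l → j ≤ k → countLess j (delete k l) ≡ countLess j l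
countLess-delete j k []       _   = refl
countLess-delete j k (y ∷ ys) j≤k with k ≡ᵇ y in k≡y
... | true rewrite ≥⇒<ᵇ≡false (subst (j ≤_) (≡ᵇ-true⇒≡ k≡y) j≤k) = countLess-delete j k ys j≤k
... | false = cong ((if y <ᵇ j then 1 else 0) +_) (countLess-delete j k ys j≤k)

code-delete : ∀ π {j k} → j < k → code (delete k π) j ≡ code π j
code-delete π {j} {k} j<k =
  trans (cong (countLess j) (after-delete j k π (<⇒≢ j<k))) (countLess-delete j k (after j π) (<⇒≤ j<k))

countLess-after : ∀ i j l → countLess j (after i l) ≤ countLess j l
countLess-after i j []       = ≤-refl
countLess-after i j (y ∷ ys) with i ≡ᵇ y
... | true  = m≤n+m _ _
... | false = ≤-trans (countLess-after i j ys) (m≤n+m _ _)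

countLess-↭ : ∀ j {l r} → l ↭ r → countLess j l ≡ countLess j r
countLess-↭ j ↭.refl            = refl
countLess-↭ j (↭.prep x l↭r)    = cong (_ +_) (countLess-↭ j l↭r)
countLess-↭ j {_ ∷ _ ∷ l} {_ ∷ _ ∷ r} (↭.swap x y l↭r) = begin
  ⟦ x ⟧ + (⟦ y ⟧ + countLess j l)  ≡⟨ sym (+-assoc ⟦ x ⟧ ⟦ y ⟧ _) ⟩
  ⟦ x ⟧ + ⟦ y ⟧ + countLess j l    ≡⟨ cong₂ _+_ (+-comm ⟦ x ⟧ ⟦ y ⟧) (countLess-↭ j l↭r) ⟩
  ⟦ y ⟧ + ⟦ x ⟧ + countLess j r    ≡⟨ +-assoc ⟦ y ⟧ ⟦ x ⟧ _ ⟩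
  ⟦ y ⟧ + (⟦ x ⟧ + countLess j r)  ∎
  where
    open ≡-Reasoning
    ⟦_⟧ : ℕ → ℕ
    ⟦ z ⟧ = if z <ᵇ j then 1 else 0
countLess-↭ j (↭.trans l↭m m↭r) = trans (countLess-↭ j l↭m) (countLess-↭ j m↭r)

countLess-map-suc : ∀ j l → countLess (suc j) (map suc l) ≡ countLess j l
countLess-map-suc j []      = refl
countLess-map-suc j (y ∷ l) = cong (_ +_) (countLess-map-suc j l)

countLess-++ : ∀ j l r → countLess j (l ++ r) ≡ countLess j l + countLess j r
countLess-++ j []      r = refl
countLess-++ j (y ∷ l) r =
  trans (cong (_ +_) (countLess-++ j l r)) (sym (+-assoc (if y <ᵇ j then 1 else 0) (countLess j l) _))

countLess-upTo : ∀ j n → countLess j (upTo n) ≡ n ⊓ j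
countLess-upTo j zero    = refl
countLess-upTo j (suc n) = begin
  countLess j (upTo (suc n))                      ≡⟨ cong (countLess j) (sym (upTo-∷ʳ n)) ⟩
  countLess j (upTo n ∷ʳ n)                       ≡⟨ countLess-++ j (upTo n) (n ∷ []) ⟩
  countLess j (upTo n) + countLess j (n ∷ [])     ≡⟨ cong (_+ countLess j (n ∷ [])) (countLess-upTo j n) ⟩
  n ⊓ j + ((if n <ᵇ j then 1 else 0) + 0)         ≡⟨ last (n <? j) ⟩
  suc n ⊓ j                                       ∎
  where
    open ≡-Reasoning
    last : Dec (n < j) → n ⊓ j + ((if n <ᵇ j then 1 else 0) + 0) ≡ suc n ⊓ j
    last (yes n<j) rewrite <⇒<ᵇ≡true n<j | m≤n⇒m⊓n≡m (<⇒≤ n<j) | m≤n⇒m⊓n≡m n<j = +-comm n 1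
    last (no  n≮j) rewrite ≥⇒<ᵇ≡false (≮⇒≥ n≮j) | m≥n⇒m⊓n≡n (≮⇒≥ n≮j)
                         | m≥n⇒m⊓n≡n (m≤n⇒m≤1+n (≮⇒≥ n≮j)) = +-identityʳ j

code-bound : ∀ {n π} i → π ↭ oneToN n → code π (suc i) ≤ i
code-bound {n} {π} i π↭ = begin
  code π (suc i)                         ≤⟨ countLess-after (suc i) (suc i) π ⟩
  countLess (suc i) π                    ≡⟨ countLess-↭ (suc i) π↭ ⟩
  countLess (suc i) (map suc (upTo n))   ≡⟨ countLess-map-suc i (upTo n) ⟩
  countLess i (upTo n)                   ≡⟨ countLess-upTo i n ⟩
  n ⊓ i                                  ≤⟨ m⊓n≤n n i ⟩
  i                                      ∎
  where open ≤-Reasoning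

ΨAux-not-ImmFollowedBy : ∀ k π j → suc j ≤ k → code π (suc j) ≤ code π j → code π j < j →
                         ¬ ImmFollowedBy (suc j) j (ΨAux k π)
ΨAux-not-ImmFollowedBy (suc k) π (suc i) (s≤s j≤k) c′≤c (s≤s c≤i) with m≤n⇒m<n∨m≡n j≤k
... | inj₁ j<k =
  ΨAux-not-ImmFollowedBy k π₁ (suc i) j<k
    (subst₂ _≤_ (sym (code-delete π (s≤s j<k))) (sym (code-delete π (s≤s j≤k))) c′≤c)
    (subst (_< suc i) (sym (code-delete π (s≤s j≤k))) (s≤s c≤i))
  ∘ ImmFollowedBy-insertAt⁻ _ _ (>⇒≢ (s≤s j<k)) (>⇒≢ (s≤s j≤k))
  where π₁ = delete (suc k) π
... | inj₂ refl =
  insertAt-two-maxima (ΨAux i π₂) (ΨAux-< i π₂)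
    (subst₂ _≤_ (sym (code-delete π ≤-refl)) (sym (length-ΨAux i π₂)) c≤i)
    (subst (code π (suc (suc i)) ≤_) (sym (code-delete π ≤-refl)) c′≤c)
  where π₂ = delete (suc i) (delete (suc (suc i)) π)

lemma6p4 : (n : ℕ) (π : List ℕ) → π ↭ oneToN n →
           (i : ℕ) → 1 ≤ i → i < n → code π (suc i) ≤ code π i →
           ¬ ImmFollowedBy (suc i) i (Ψ π)
lemma6p4 n π π↭ (suc i) _ i<n c′≤c =
  ΨAux-not-ImmFollowedBy (length π) π (suc i) (subst (suc (suc i) ≤_) (sym |π|≡n) i<n) c′≤c
    (s≤s (code-bound i π↭))
  where
    |π|≡n : length π ≡ n
    |π|≡n = trans (↭-length π↭) (trans (length-map suc (upTo n)) (length-upTo n))
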